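{- Let $F$ be a forest and $t$ a positive integer. Among all graphs which are $K_t$-Ramsey, the complete graph on $r(K_t)$ vertices has the minimum number of copies of $F$.
   Context: All graphs are finite and simple. A graph $G$ is $K_t$-Ramsey if every two-coloring of the edges of $G$ contains a monochromatic copy of $K_t$; $r(K_t)$ is the two-color Ramsey number of $K_t$ (so $K_{r(K_t)}$ is $K_t$-Ramsey). Copies of $F$ are counted as unlabeled subgraphs isomorphic to $F$. -}

module Defs where

open import Data.Nat using (ℕ; zero; suc; _≤_; _<_)
open import Data.Bool using (Bool; true; false; not; _∧_; _∨_)
open import Data.Bool.Properties using () renaming (_≟_ to _≟ᵇ_)
open import Data.Fin using (Fin; zero; suc; inject₁; fromℕ; _≟_)
open import Data.Vec using (Vec; []; _∷_; lookup; tabulate)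
open import Data.Vec.Properties using () renaming (≡-dec to vec-≡-dec)
open import Data.List using (List; []; _∷_; [_]; length; cartesianProductWith; allFin; filterᵇ; map; deduplicate)
open import Data.Bool.ListAction using (any; all)
open import Data.Product using (Σ; ∃; _×_; _,_)
open import Data.Product.Properties using () renaming (≡-dec to ×-≡-dec)
open import Relation.Nullary using (¬_; ⌊_⌋)
open import Relation.Binary.PropositionalEquality using (_≡_; _≢_)
open import Function.Definitions using (Injective)

record Graph (n : ℕ) : Set where
  field
    adj    : Fin n → Fin n → Bool
    sym    : ∀ i j → adj i j ≡ adj j i
    irrefl : ∀ i → adj i i ≡ false
open Graph public

_==_ : ∀ {n} → Fin n → Fin n → Bool
i == j = ⌊ i ≟ j ⌋

complete : (n : ℕ) → Graph n
complete n = record { adj = λ i j → not (i == j) ; sym = symK ; irrefl = irrK }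
  where
  open import Relation.Binary.PropositionalEquality using (refl) renaming (sym to ≡-sym)
  open import Relation.Nullary using (yes; no)
  symK : ∀ (i j : Fin n) → not (i == j) ≡ not (j == i)
  symK i j with i ≟ j | j ≟ i
  ... | yes _ | yes _ = refl
  ... | no _  | no _  = refl
  ... | yes p | no q  = Data.Empty.⊥-elim (q (≡-sym p)) where import Data.Empty
  ... | no p  | yes q = Data.Empty.⊥-elim (p (≡-sym q)) where import Data.Empty
  irrK : ∀ (i : Fin n) → not (i == i) ≡ false
  irrK i with i ≟ i
  ... | yes _ = refl
  ... | no p  = Data.Empty.⊥-elim (p refl) where import Data.Empty

record Cycle {n : ℕ} (G : Graph n) : Set where
  field
    m      : ℕ
    f      : Fin (suc (suc (suc m))) → Fin n
    inj    : Injective _≡_ _≡_ f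
    step   : ∀ (i : Fin (suc (suc m))) → adj G (f (inject₁ i)) (f (suc i)) ≡ true
    close  : adj G (f (fromℕ (suc (suc m)))) (f zero) ≡ true

IsForest : ∀ {n} → Graph n → Set
IsForest G = ¬ Cycle G

-- G is K_t-Ramsey: every two-colouring of the edges of G (a symmetric
-- colour function, only its values on edges matter) has a monochromatic K_t.
KtRamsey : (t : ℕ) → ∀ {n} → Graph n → Set
KtRamsey t {n} G =
  (c : Fin n → Fin n → Bool) → (∀ i j → c i j ≡ c j i) →
  Σ Bool λ b → Σ (Fin t → Fin n) λ f → Injective _≡_ _≡_ f ×
    (∀ i j → i ≢ j → (adj G (f i) (f j) ≡ true) × (c (f i) (f j) ≡ b))

IsRamseyNumber : (t r : ℕ) → Set
IsRamseyNumber t r = KtRamsey t (complete r) × (∀ s → s < r → ¬ KtRamsey t (complete s))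

-- Counting copies of F in G (unlabeled subgraphs of G isomorphic to F).
-- Every such subgraph is the image (vertex set f(V F), edge set f(E F)) of an
-- injective homomorphism f : F → G, and conversely.

allMaps : (k n : ℕ) → List (Vec (Fin n) k)
allMaps zero    n = [ [] ]
allMaps (suc k) n = cartesianProductWith _∷_ (allFin n) (allMaps k n)

isInjHom : ∀ {k n} → Graph k → Graph n → Vec (Fin n) k → Bool
isInjHom {k} F G f =
  all (λ i → all (λ j →
        (i == j ∨ not (lookup f i == lookup f j)) ∧
        (not (adj F i j) ∨ adj G (lookup f i) (lookup f j)))
      (allFin k)) (allFin k)

Subgraph : ℕ → Set
Subgraph n = Vec Bool n × Vec (Vec Bool n) n

image : ∀ {k n} → Graph k → Vec (Fin n) k → Subgraph n
image {k} F f =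
  tabulate (λ v → any (λ i → lookup f i == v) (allFin k)) ,
  tabulate (λ u → tabulate (λ v →
    any (λ i → any (λ j → adj F i j ∧ (lookup f i == u) ∧ (lookup f j == v))
          (allFin k)) (allFin k)))

subgraph-≟ : ∀ {n} (x y : Subgraph n) → Relation.Nullary.Dec (x ≡ y)
subgraph-≟ = ×-≡-dec (vec-≡-dec _≟ᵇ_) (vec-≡-dec (vec-≡-dec _≟ᵇ_))

copies : ∀ {k n} → Graph k → Graph n → ℕ
copies F G = length (deduplicate subgraph-≟ (map (image F) (filterᵇ (isInjHom F G) (allMaps _ _))))

{-# OPTIONS --safe #-}
-- Every copy of F in G is the image of exactly |Aut F| injective homomorphisms F → G, so it
-- is enough to compare numbers of injective homomorphisms.  Write r = r(K_t) = c + 1.  A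
-- K_t-Ramsey graph G has no proper c-colouring, since composing with it would make K_c
-- K_t-Ramsey; hence deleting vertices of degree < c one at a time never empties G, and what
-- remains is a nonempty subgraph H of minimum degree ≥ c, so on at least r vertices.  Embed
-- the forest F one leaf at a time: given an embedding of the first j vertices, the next leaf
-- has exactly r − j images in K_r, while in H it can go to any of the ≥ c − (j − 1) unused
-- neighbours of its parent's image (any of the ≥ r − j unused vertices if it is isolated).
-- So F has at most as many injective homomorphisms into K_r as into H, and at most as many
-- into H as into G.
module Submission where

open import Defs hiding (sym)
open import Algebra.Properties.CommutativeSemigroup using (interchange)
open import Data.Bool using (Bool; true; false; not; _∧_; _∨_; if_then_else_)
open import Data.Bool.ListAction using (any; all)
open import Data.Bool.Properties
  using (T-≡; ∧-conicalˡ; ∧-conicalʳ; ∨-comm; ∧-identityʳ; not-injective) renaming (_≟_ to _≟ᵇ_)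
open import Data.Empty using (⊥; ⊥-elim)
open import Data.Fin using (Fin; zero; suc; _≟_; toℕ; fromℕ; fromℕ<; inject₁; punchIn; punchOut)
open import Data.Fin.Properties
  using (any?; all?; ¬∀⟶∃¬; ¬∀⟶∃¬-smallest; pigeonhole; toℕ<n; toℕ-fromℕ<; toℕ-inject; toℕ-inject₁;
         toℕ-fromℕ; toℕ-injective;
         suc-injective; punchIn-injective; punchIn-punchOut; punchOut-injective; injective⇒≤)
open import Data.Fin.Permutation using (Permutation′; _⟨$⟩ʳ_; _⟨$⟩ˡ_; inverseˡ; inverseʳ; transpose)
open import Data.List
  using (List; []; _∷_; length; filterᵇ; map; _++_; allFin; tabulate; deduplicate;
         cartesianProduct; cartesianProductWith)
open import Data.List.Membership.Propositional using (_∈_)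
open import Data.List.Membership.Propositional.Properties
  using (∈-allFin; ∈-cartesianProductWith⁺; ∈-filter⁺; ∈-filter⁻; ∈-map⁺; ∈-map⁻;
         ∈-deduplicate⁺; ∈-deduplicate⁻; ∈-cartesianProduct⁺; ∈-cartesianProduct⁻)
open import Data.List.Properties using (length-++; length-map; length-tabulate; filter-++; length-removeAt′)
open import Data.List.Relation.Unary.Any using (here; there; index; _─_)
open import Data.List.Relation.Unary.All using ([]; _∷_) renaming (lookup to All-lookup)
import Data.List.Relation.Unary.All.Properties as All
import Data.List.Relation.Unary.Any.Properties as Any
open import Data.List.Relation.Unary.AllPairs using ([]; _∷_)
open import Data.List.Relation.Unary.Unique.Propositional using (Unique)
open import Data.List.Relation.Unary.Unique.Propositional.Properties
  using (cartesianProductWith⁺; cartesianProduct⁺; allFin⁺; filter⁺)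
import Data.List.Relation.Unary.Unique.DecPropositional.Properties as UniqueDec
open import Data.Nat using (ℕ; zero; suc; _≤_; _<_; _+_; _*_; _∸_; z≤n; s≤s; _<?_; >-nonZero)
open import Data.Nat.Properties hiding (_≟_; suc-injective)
open import Data.Product using (Σ; ∃; _×_; _,_; proj₁; proj₂)
open import Data.Sum using (_⊎_; inj₁; inj₂)
open import Data.Vec using (Vec; []; _∷_; lookup) renaming (tabulate to tabulateᵛ)
open import Data.Vec.Properties using (lookup∘tabulate; tabulate-cong; ∷-injective)
open import Data.Vec.Relation.Binary.Pointwise.Extensional using (ext; Pointwise-≡⇒≡)
open import Function using (_∘_; _⇔_; Equivalence; mk⇔)
open import Function.Definitions using (Injective)
open import Relation.Binary using (tri<; tri≈; tri>)
open import Relation.Binary.PropositionalEquality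
open import Relation.Nullary using (¬_; yes; no; Dec; ⌊_⌋)
open import Relation.Nullary.Decidable using (T?; _×-dec_; ¬?; decidable-stable)

==-refl : ∀ {n} (i : Fin n) → (i == i) ≡ true
==-refl i with i ≟ i
... | yes _  = refl
... | no i≢i = ⊥-elim (i≢i refl)

≡⇒== : ∀ {n} {i j : Fin n} → i ≡ j → (i == j) ≡ true
≡⇒== {i = i} refl = ==-refl i

==⇒≡ : ∀ {n} {i j : Fin n} → (i == j) ≡ true → i ≡ j
==⇒≡ {i = i} {j} h with i ≟ j
... | yes i≡j = i≡j
==⇒≡ () | no _

≢⇒==-false : ∀ {n} {i j : Fin n} → i ≢ j → (i == j) ≡ false
≢⇒==-false {i = i} {j} i≢j with i ≟ j
... | yes i≡j = ⊥-elim (i≢j i≡j)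
... | no _    = refl

true≢false : ∀ {b} → b ≡ true → b ≡ false → ⊥
true≢false refl ()

all-allFin⁻ : ∀ {k} (p : Fin k → Bool) → all p (allFin k) ≡ true → ∀ i → p i ≡ true
all-allFin⁻ p h i = Equivalence.to T-≡ (All.tabulate⁻ (All.all⁺ p _ (Equivalence.from T-≡ h)) i)

all-allFin⁺ : ∀ {k} (p : Fin k → Bool) → (∀ i → p i ≡ true) → all p (allFin k) ≡ true
all-allFin⁺ p h = Equivalence.to T-≡ (All.all⁻ p (All.tabulate⁺ (Equivalence.from T-≡ ∘ h)))

any-allFin⁻ : ∀ {k} (p : Fin k → Bool) → any p (allFin k) ≡ true → ∃ λ i → p i ≡ true
any-allFin⁻ p h with Any.tabulate⁻ (Any.any⁻ p _ (Equivalence.from T-≡ h))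
... | i , pi = i , Equivalence.to T-≡ pi

any-allFin⁺ : ∀ {k} (p : Fin k → Bool) i → p i ≡ true → any p (allFin k) ≡ true
any-allFin⁺ p i h = Equivalence.to T-≡ (Any.any⁺ p (Any.tabulate⁺ i (Equivalence.from T-≡ h)))

not∨-elim : ∀ {c d} → (not c ∨ d) ≡ true → c ≡ true → d ≡ true
not∨-elim {true} h refl = h

not∨-intro : ∀ c d → (c ≡ true → d ≡ true) → (not c ∨ d) ≡ true
not∨-intro false d h = refl
not∨-intro true  d h = h refl

∧-intro : ∀ {a b} → a ≡ true → b ≡ true → (a ∧ b) ≡ true
∧-intro refl refl = refl

bool-ext : ∀ {a b : Bool} → (a ≡ true → b ≡ true) → (b ≡ true → a ≡ true) → a ≡ b
bool-ext {true}  {true}  _ _ = refl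
bool-ext {true}  {false} f _ = sym (f refl)
bool-ext {false} {true}  _ g = g refl
bool-ext {false} {false} _ _ = refl

+-interchange : ∀ a b c d → (a + b) + (c + d) ≡ (a + c) + (b + d)
+-interchange = interchange +-commutativeSemigroup

ind : Bool → ℕ
ind true  = 1
ind false = 0

ind-mono : ∀ {b c} → (b ≡ true → c ≡ true) → ind b ≤ ind c
ind-mono {false} _ = z≤n
ind-mono {true}  h rewrite h refl = ≤-refl

ind≤1 : ∀ b → ind b ≤ 1
ind≤1 true  = ≤-refl
ind≤1 false = z≤n

ind-split : ∀ a b → ind a ≡ ind (a ∧ b) + ind (a ∧ not b)
ind-split true  true  = refl
ind-split true  false = refl
ind-split false _     = refl

ind-not : ∀ b → ind b + ind (not b) ≡ 1
ind-not true  = refl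
ind-not false = refl

ind-∨ : ∀ a b → ind (a ∨ b) ≤ ind a + ind b
ind-∨ true  _ = s≤s z≤n
ind-∨ false _ = ≤-refl

count : {A : Set} → (A → Bool) → List A → ℕ
count p xs = length (filterᵇ p xs)

count-∷ : ∀ {A : Set} (p : A → Bool) x xs → count p (x ∷ xs) ≡ ind (p x) + count p xs
count-∷ p x xs with p x
... | true  = refl
... | false = refl

count-++ : ∀ {A : Set} (p : A → Bool) xs ys → count p (xs ++ ys) ≡ count p xs + count p ys
count-++ p xs ys = trans (cong length (filter-++ (T? ∘ p) xs ys)) (length-++ (filterᵇ p xs))

count-map : ∀ {A B : Set} (p : B → Bool) (h : A → B) xs → count p (map h xs) ≡ count (p ∘ h) xs
count-map p h []       = refl
count-map p h (x ∷ xs) = begin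
  count p (h x ∷ map h xs)     ≡⟨ count-∷ p (h x) (map h xs) ⟩
  ind (p (h x)) + count p (map h xs) ≡⟨ cong (ind (p (h x)) +_) (count-map p h xs) ⟩
  ind (p (h x)) + count (p ∘ h) xs   ≡⟨ count-∷ (p ∘ h) x xs ⟨
  count (p ∘ h) (x ∷ xs)       ∎
  where open ≡-Reasoning

∈-─ : ∀ {B : Set} {y z : B} (ys : List B) (p : y ∈ ys) → z ∈ ys → z ≢ y → z ∈ (ys ─ p)
∈-─ (_ ∷ ys) (here refl) (here refl) z≢y = ⊥-elim (z≢y refl)
∈-─ (_ ∷ ys) (here refl) (there q)   z≢y = q
∈-─ (_ ∷ ys) (there p)   (here refl) z≢y = here refl
∈-─ (_ ∷ ys) (there p)   (there q)   z≢y = there (∈-─ ys p q z≢y)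

length-≤-injection : ∀ {A B : Set} (xs : List A) (ys : List B) (φ : (x : A) → x ∈ xs → B) → Unique xs →
  (∀ x y px py → φ x px ≡ φ y py → x ≡ y) → (∀ x px → φ x px ∈ ys) → length xs ≤ length ys
length-≤-injection []       ys φ _           φ-inj φ∈ = z≤n
length-≤-injection (x ∷ xs) ys φ (x∉xs ∷ u) φ-inj φ∈ =
  subst (suc (length xs) ≤_) (sym (length-removeAt′ ys (index φx∈ys)))
    (s≤s (length-≤-injection xs (ys ─ φx∈ys) (λ y py → φ y (there py)) u
      (λ y z py pz → φ-inj y z (there py) (there pz))
      (λ y py → ∈-─ ys φx∈ys (φ∈ y (there py))
         (λ e → All-lookup x∉xs py (sym (φ-inj y x (there py) (here refl) e))))))
  where φx∈ys = φ∈ x (here refl)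

countFin : (n : ℕ) → (Fin n → Bool) → ℕ
countFin zero    p = 0
countFin (suc n) p = ind (p zero) + countFin n (p ∘ suc)

count-tabulate : ∀ {A : Set} (p : A → Bool) {n} (f : Fin n → A) → count p (tabulate f) ≡ countFin n (p ∘ f)
count-tabulate p {zero}  f = refl
count-tabulate p {suc n} f =
  trans (count-∷ p (f zero) (tabulate (f ∘ suc))) (cong (ind (p (f zero)) +_) (count-tabulate p (f ∘ suc)))

countFin-false : ∀ n → countFin n (λ _ → false) ≡ 0
countFin-false zero    = refl
countFin-false (suc n) = countFin-false n

countFin-mono : ∀ n {p q : Fin n → Bool} → (∀ i → p i ≡ true → q i ≡ true) → countFin n p ≤ countFin n q
countFin-mono zero    h = z≤n
countFin-mono (suc n) h = +-mono-≤ (ind-mono (h zero)) (countFin-mono n (h ∘ suc))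

countFin-cong : ∀ n {p q : Fin n → Bool} → (∀ i → p i ≡ q i) → countFin n p ≡ countFin n q
countFin-cong zero    h = refl
countFin-cong (suc n) h = cong₂ _+_ (cong ind (h zero)) (countFin-cong n (h ∘ suc))

countFin-≤ : ∀ n (p : Fin n → Bool) → countFin n p ≤ n
countFin-≤ zero    p = z≤n
countFin-≤ (suc n) p = +-mono-≤ (ind≤1 (p zero)) (countFin-≤ n (p ∘ suc))

countFin-split : ∀ n (p q : Fin n → Bool) →
  countFin n p ≡ countFin n (λ i → p i ∧ q i) + countFin n (λ i → p i ∧ not (q i))
countFin-split zero    p q = refl
countFin-split (suc n) p q = begin
  ind (p zero) + countFin n (p ∘ suc)
    ≡⟨ cong₂ _+_ (ind-split (p zero) (q zero)) (countFin-split n (p ∘ suc) (q ∘ suc)) ⟩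
  (ind (p zero ∧ q zero) + ind (p zero ∧ not (q zero))) + (countFin n _ + countFin n _)
    ≡⟨ +-interchange (ind (p zero ∧ q zero)) (ind (p zero ∧ not (q zero))) _ _ ⟩
  countFin (suc n) (λ i → p i ∧ q i) + countFin (suc n) (λ i → p i ∧ not (q i)) ∎
  where open ≡-Reasoning

countFin-not : ∀ n (p : Fin n → Bool) → countFin n p + countFin n (not ∘ p) ≡ n
countFin-not zero    p = refl
countFin-not (suc n) p = begin
  (ind (p zero) + countFin n (p ∘ suc)) + (ind (not (p zero)) + countFin n (not ∘ p ∘ suc))
    ≡⟨ +-interchange (ind (p zero)) (countFin n (p ∘ suc)) _ _ ⟩
  (ind (p zero) + ind (not (p zero))) + (countFin n (p ∘ suc) + countFin n (not ∘ p ∘ suc))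
    ≡⟨ cong₂ _+_ (ind-not (p zero)) (countFin-not n (p ∘ suc)) ⟩
  suc n ∎
  where open ≡-Reasoning

countFin-not≡∸ : ∀ n (p : Fin n → Bool) → countFin n (not ∘ p) ≡ n ∸ countFin n p
countFin-not≡∸ n p = trans (sym (m+n∸m≡n (countFin n p) _)) (cong (_∸ countFin n p) (countFin-not n p))

countFin-∨ : ∀ n (p q : Fin n → Bool) → countFin n (λ i → p i ∨ q i) ≤ countFin n p + countFin n q
countFin-∨ zero    p q = z≤n
countFin-∨ (suc n) p q =
  ≤-trans (+-mono-≤ (ind-∨ (p zero) (q zero)) (countFin-∨ n (p ∘ suc) (q ∘ suc)))
          (≤-reflexive (+-interchange (ind (p zero)) (ind (q zero)) _ _))

countFin-pos : ∀ n (p : Fin n → Bool) i → p i ≡ true → 1 ≤ countFin n p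
countFin-pos (suc n) p zero    h rewrite h = s≤s z≤n
countFin-pos (suc n) p (suc i) h = ≤-trans (countFin-pos n (p ∘ suc) i h) (m≤n+m _ _)

countFin-<-size : ∀ n (p : Fin n → Bool) i → p i ≡ false → countFin n p < n
countFin-<-size (suc n) p zero    h rewrite h = s≤s (countFin-≤ n (p ∘ suc))
countFin-<-size (suc n) p (suc i) h =
  ≤-trans (≤-reflexive (sym (+-suc (ind (p zero)) (countFin n (p ∘ suc)))))
          (+-mono-≤ (ind≤1 (p zero)) (countFin-<-size n (p ∘ suc) i h))

suc==suc : ∀ {n} (v a : Fin n) → (suc v == suc a) ≡ (v == a)
suc==suc v a with v ≟ a
... | yes refl = refl
... | no _     = refl

countFin-== : ∀ n (a : Fin n) → countFin n (_== a) ≤ 1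
countFin-== (suc n) zero    = ≤-reflexive (cong suc (countFin-false n))
countFin-== (suc n) (suc a) =
  subst (_≤ 1) (sym (cong₂ _+_ (cong ind (≢⇒==-false {i = zero} {suc a} λ ()))
                              (countFin-cong n (λ v → suc==suc v a))))
    (countFin-== n a)

sumList : ∀ {A : Set} → List A → (A → ℕ) → ℕ
sumList []       w = 0
sumList (x ∷ xs) w = w x + sumList xs w

sumList-zero : ∀ {A : Set} (xs : List A) → sumList xs (λ _ → 0) ≡ 0
sumList-zero []       = refl
sumList-zero (x ∷ xs) = sumList-zero xs

sumList-+ : ∀ {A : Set} (xs : List A) (a b : A → ℕ) → sumList xs (λ x → a x + b x) ≡ sumList xs a + sumList xs b
sumList-+ []       a b = refl
sumList-+ (x ∷ xs) a b =
  trans (cong (a x + b x +_) (sumList-+ xs a b)) (+-interchange (a x) (b x) (sumList xs a) (sumList xs b))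

sumList-mono : ∀ {A : Set} (xs : List A) {w w′ : A → ℕ} → (∀ x → w x ≤ w′ x) → sumList xs w ≤ sumList xs w′
sumList-mono []       h = z≤n
sumList-mono (x ∷ xs) h = +-mono-≤ (h x) (sumList-mono xs h)

count≡sumList : ∀ {A : Set} (p : A → Bool) xs → count p xs ≡ sumList xs (ind ∘ p)
count≡sumList p []       = refl
count≡sumList p (x ∷ xs) = trans (count-∷ p x xs) (cong (ind (p x) +_) (count≡sumList p xs))

sumList-ind-* : ∀ {A : Set} (xs : List A) (p : A → Bool) c → sumList xs (λ x → ind (p x) * c) ≡ count p xs * c
sumList-ind-* []       p c = refl
sumList-ind-* (x ∷ xs) p c = begin
  ind (p x) * c + sumList xs (λ x → ind (p x) * c) ≡⟨ cong (ind (p x) * c +_) (sumList-ind-* xs p c) ⟩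
  ind (p x) * c + count p xs * c                    ≡⟨ *-distribʳ-+ c (ind (p x)) (count p xs) ⟨
  (ind (p x) + count p xs) * c                      ≡⟨ cong (_* c) (count-∷ p x xs) ⟨
  count p (x ∷ xs) * c                              ∎
  where open ≡-Reasoning

count-cartesianProductWith : ∀ {A B C : Set} (f : A → B → C) (p : C → Bool) {n} (t : Fin n → A) (ys : List B) →
  count p (cartesianProductWith f (tabulate t) ys) ≡ sumList ys (λ y → countFin n (λ i → p (f (t i) y)))
count-cartesianProductWith f p {zero}  t ys = sym (sumList-zero ys)
count-cartesianProductWith f p {suc n} t ys = begin
  count p (map (f (t zero)) ys ++ cartesianProductWith f (tabulate (t ∘ suc)) ys)
    ≡⟨ count-++ p (map (f (t zero)) ys) _ ⟩
  count p (map (f (t zero)) ys) + count p (cartesianProductWith f (tabulate (t ∘ suc)) ys)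
    ≡⟨ cong₂ _+_ (trans (count-map p (f (t zero)) ys) (count≡sumList _ ys))
                 (count-cartesianProductWith f p (t ∘ suc) ys) ⟩
  sumList ys (λ y → ind (p (f (t zero) y))) + sumList ys (λ y → countFin n (λ i → p (f (t (suc i)) y)))
    ≡⟨ sumList-+ ys _ _ ⟨
  sumList ys (λ y → countFin (suc n) (λ i → p (f (t i) y))) ∎
  where open ≡-Reasoning

countFin-≥-injection : ∀ {c n} (f : Fin c → Fin n) (p : Fin n → Bool) →
  Injective _≡_ _≡_ f → (∀ x → p (f x) ≡ true) → c ≤ countFin n p
countFin-≥-injection {c} {n} f p f-inj pf =
  subst₂ _≤_ (length-tabulate {n = c} (λ i → i)) (count-tabulate p (λ i → i))
  (length-≤-injection (allFin c) (filterᵇ p (allFin n)) (λ x _ → f x) (allFin⁺ c) (λ _ _ _ _ → f-inj)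
    (λ x _ → ∈-filter⁺ (T? ∘ p) (∈-allFin (f x)) (Equivalence.from T-≡ (pf x))))

length-cartesianProduct : ∀ {A B : Set} (xs : List A) (ys : List B) →
  length (cartesianProduct xs ys) ≡ length xs * length ys
length-cartesianProduct []       ys = refl
length-cartesianProduct (x ∷ xs) ys =
  trans (length-++ (map (x ,_) ys)) (cong₂ _+_ (length-map (x ,_) ys) (length-cartesianProduct xs ys))

find-or : ∀ {A : Set} → (A → Bool) → List A → A → A
find-or p []       d = d
find-or p (x ∷ xs) d = if p x then x else find-or p xs d

find-or-satisfies : ∀ {A : Set} (p : A → Bool) xs d {x} → x ∈ xs → p x ≡ true →
  p (find-or p xs d) ≡ true × find-or p xs d ∈ xs
find-or-satisfies p (y ∷ xs) d x∈ px with p y in py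
... | true = py , here refl
find-or-satisfies p (y ∷ xs) d (here refl) px | false = ⊥-elim (true≢false px py)
find-or-satisfies p (y ∷ xs) d (there x∈) px | false =
  let found , found∈ = find-or-satisfies p xs d x∈ px in found , there found∈

find-or-default-irrelevant : ∀ {A : Set} (p : A → Bool) xs d d′ {x} → x ∈ xs → p x ≡ true →
  find-or p xs d ≡ find-or p xs d′
find-or-default-irrelevant p (y ∷ xs) d d′ x∈ px with p y in py
... | true = refl
find-or-default-irrelevant p (y ∷ xs) d d′ (here refl) px | false = ⊥-elim (true≢false px py)
find-or-default-irrelevant p (y ∷ xs) d d′ (there x∈) px | false = find-or-default-irrelevant p xs d d′ x∈ px

injective⇒surjective : ∀ {k} (σ : Fin k → Fin k) → Injective _≡_ _≡_ σ → ∀ j → ∃ λ i → σ i ≡ j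
injective⇒surjective {k} σ σ-inj j with any? (λ i → σ i ≟ j)
... | yes found = found
injective⇒surjective {suc k} σ σ-inj j | no ¬found =
  ⊥-elim (<-irrefl refl (injective⇒≤ {f = λ i → punchOut (j≢σ i)} (σ-inj ∘ punchOut-injective (j≢σ _) (j≢σ _))))
  where
  j≢σ : ∀ i → j ≢ σ i
  j≢σ i e = ¬found (i , sym e)

record IsInjHom {k n} (F : Graph k) (G : Graph n) (φ : Fin k → Fin n) : Set where
  field
    injective : Injective _≡_ _≡_ φ
    hom       : ∀ {i j} → adj F i j ≡ true → adj G (φ i) (φ j) ≡ true
open IsInjHom

IsInjHom-cong : ∀ {k n} {F : Graph k} {G : Graph n} {φ ψ : Fin k → Fin n} →
  (∀ i → φ i ≡ ψ i) → IsInjHom F G φ → IsInjHom F G ψ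
IsInjHom-cong {G = G} φ≗ψ h = record
  { injective = λ {i} {j} e → injective h (trans (φ≗ψ i) (trans e (sym (φ≗ψ j))))
  ; hom       = λ {i} {j} a → subst₂ (λ u v → adj G u v ≡ true) (φ≗ψ i) (φ≗ψ j) (hom h a) }

isInjHom⇒IsInjHom : ∀ {k n} (F : Graph k) (G : Graph n) f → isInjHom F G f ≡ true → IsInjHom F G (lookup f)
isInjHom⇒IsInjHom F G f h = record
  { injective = λ {i} {j} e →
      ==⇒≡ (not∨-elim (subst (_≡ true) (∨-comm (i == j) _) (∧-conicalˡ _ _ (cell i j))) (≡⇒== e))
  ; hom       = λ {i} {j} → not∨-elim (∧-conicalʳ _ _ (cell i j)) }
  where
  cell = λ i j → all-allFin⁻ _ (all-allFin⁻ _ h i) j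

IsInjHom⇒isInjHom : ∀ {k n} (F : Graph k) (G : Graph n) f → IsInjHom F G (lookup f) → isInjHom F G f ≡ true
IsInjHom⇒isInjHom F G f h =
  all-allFin⁺ _ λ i → all-allFin⁺ _ λ j →
    ∧-intro (subst (_≡ true) (∨-comm _ (i == j)) (not∨-intro _ _ λ e → ≡⇒== (injective h (==⇒≡ e))))
            (not∨-intro _ _ (hom h))

∈-allMaps : ∀ k n (f : Vec (Fin n) k) → f ∈ allMaps k n
∈-allMaps zero    n []      = here refl
∈-allMaps (suc k) n (v ∷ f) = ∈-cartesianProductWith⁺ _∷_ (∈-allFin v) (∈-allMaps k n f)

allMaps-unique : ∀ k n → Unique (allMaps k n)
allMaps-unique zero    n = [] ∷ []
allMaps-unique (suc k) n = cartesianProductWith⁺ _∷_ ∷-injective (allFin⁺ n) (allMaps-unique k n)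

count-allMaps-suc : ∀ k n (p : Vec (Fin n) (suc k) → Bool) →
  count p (allMaps (suc k) n) ≡ sumList (allMaps k n) (λ f → countFin n (λ v → p (v ∷ f)))
count-allMaps-suc k n p = count-cartesianProductWith _∷_ p (λ v → v) (allMaps k n)

injHoms : ∀ {k n} → Graph k → Graph n → List (Vec (Fin n) k)
injHoms {k} {n} F G = filterᵇ (isInjHom F G) (allMaps k n)

#injHom : ∀ {k n} → Graph k → Graph n → ℕ
#injHom F G = length (injHoms F G)

injHoms-unique : ∀ {k n} (F : Graph k) (G : Graph n) → Unique (injHoms F G)
injHoms-unique F G = filter⁺ (T? ∘ isInjHom F G) (allMaps-unique _ _)

∈-injHoms⁺ : ∀ {k n} (F : Graph k) (G : Graph n) f → IsInjHom F G (lookup f) → f ∈ injHoms F G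
∈-injHoms⁺ F G f h =
  ∈-filter⁺ (T? ∘ isInjHom F G) (∈-allMaps _ _ f) (Equivalence.from T-≡ (IsInjHom⇒isInjHom F G f h))

∈-injHoms⁻ : ∀ {k n} (F : Graph k) (G : Graph n) {f} → f ∈ injHoms F G → IsInjHom F G (lookup f)
∈-injHoms⁻ F G {f} f∈ =
  isInjHom⇒IsInjHom F G f (Equivalence.to T-≡ (proj₂ (∈-filter⁻ (T? ∘ isInjHom F G) {xs = allMaps _ _} f∈)))

IsInjHom-id : ∀ {n} (G : Graph n) → IsInjHom G G (λ v → v)
IsInjHom-id G = record { injective = λ e → e ; hom = λ a → a }

#injHom-≤ : ∀ {k n k′ n′} {F : Graph k} {G : Graph n} {F′ : Graph k′} {G′ : Graph n′}
  (Φ : (Fin k → Fin n) → Fin k′ → Fin n′) →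
  (∀ φ → IsInjHom F G φ → IsInjHom F′ G′ (Φ φ)) →
  (∀ φ ψ → IsInjHom F G φ → (∀ i → Φ φ i ≡ Φ ψ i) → ∀ i → φ i ≡ ψ i) →
  #injHom F G ≤ #injHom F′ G′
#injHom-≤ {k} {n} {k′} {n′} {F} {G} {F′} {G′} Φ Φ-hom Φ-inj =
  length-≤-injection (injHoms F G) (injHoms F′ G′) (λ f _ → Φᵛ f) (injHoms-unique F G)
    (λ f g f∈ _ e → Pointwise-≡⇒≡ (ext (Φ-inj (lookup f) (lookup g) (∈-injHoms⁻ F G f∈)
       (λ i → trans (sym (lookup∘tabulate _ i)) (trans (cong (λ h → lookup h i) e) (lookup∘tabulate _ i))))))
    (λ f f∈ → ∈-injHoms⁺ F′ G′ (Φᵛ f)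
       (IsInjHom-cong (λ i → sym (lookup∘tabulate _ i)) (Φ-hom (lookup f) (∈-injHoms⁻ F G f∈))))
  where
  Φᵛ : Vec (Fin n) k → Vec (Fin n′) k′
  Φᵛ f = tabulateᵛ (Φ (lookup f))

IsInjHom-∘ : ∀ {k m n} {F : Graph k} {H : Graph m} {G : Graph n} {e : Fin m → Fin n} {φ : Fin k → Fin m} →
  IsInjHom H G e → IsInjHom F H φ → IsInjHom F G (e ∘ φ)
IsInjHom-∘ he hφ = record { injective = injective hφ ∘ injective he ; hom = hom he ∘ hom hφ }

#injHom-embed : ∀ {k m n} (F : Graph k) {H : Graph m} {G : Graph n} {e : Fin m → Fin n} →
  IsInjHom H G e → #injHom F H ≤ #injHom F G
#injHom-embed F {H} {G} {e} he =
  #injHom-≤ {F = F} {H} {F} {G} (e ∘_) (λ _ → IsInjHom-∘ he) (λ _ _ _ e≗ i → injective he (e≗ i))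

#injHom-precompose : ∀ {k k′ n} {F : Graph k} {F′ : Graph k′} (G : Graph n)
  {σ : Fin k′ → Fin k} (σ⁻¹ : Fin k → Fin k′) →
  IsInjHom F′ F σ → (∀ i → σ (σ⁻¹ i) ≡ i) → #injHom F G ≤ #injHom F′ G
#injHom-precompose {F = F} {F′} G {σ} σ⁻¹ hσ σσ⁻¹ = #injHom-≤ {F = F} {G} {F′} {G} (_∘ σ) (λ _ hφ → IsInjHom-∘ hφ hσ)
  (λ φ ψ _ eq i → subst (λ j → φ j ≡ ψ j) (σσ⁻¹ i) (eq (σ⁻¹ i)))

deleteVertex : ∀ {n} → Graph (suc n) → Fin (suc n) → Graph n
deleteVertex G u = record
  { adj    = λ i j → adj G (punchIn u i) (punchIn u j)
  ; sym    = λ i j → Graph.sym G (punchIn u i) (punchIn u j)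
  ; irrefl = λ i → irrefl G (punchIn u i) }

IsInjHom⇒forest : ∀ {k m} {H : Graph m} {F : Graph k} {e : Fin m → Fin k} → IsInjHom H F e → IsForest F → IsForest H
IsInjHom⇒forest {e = e} he forest c = forest record
  { m = Cycle.m c ; f = e ∘ Cycle.f c ; inj = Cycle.inj c ∘ injective he
  ; step = hom he ∘ Cycle.step c ; close = hom he (Cycle.close c) }

deleteVertex-embedding : ∀ {n} (G : Graph (suc n)) u → IsInjHom (deleteVertex G u) G (punchIn u)
deleteVertex-embedding G u = record { injective = punchIn-injective u _ _ ; hom = λ a → a }

relabel : ∀ {k} → Graph k → Permutation′ k → Graph k
relabel F π = record
  { adj    = λ i j → adj F (π ⟨$⟩ʳ i) (π ⟨$⟩ʳ j)
  ; sym    = λ i j → Graph.sym F (π ⟨$⟩ʳ i) (π ⟨$⟩ʳ j)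
  ; irrefl = λ i → irrefl F (π ⟨$⟩ʳ i) }

relabel-embedding : ∀ {k} (F : Graph k) π → IsInjHom (relabel F π) F (π ⟨$⟩ʳ_)
relabel-embedding F π = record
  { injective = λ e → trans (sym (inverseˡ π)) (trans (cong (π ⟨$⟩ˡ_) e) (inverseˡ π))
  ; hom       = λ a → a }

relabel-embedding⁻¹ : ∀ {k} (F : Graph k) π → IsInjHom F (relabel F π) (π ⟨$⟩ˡ_)
relabel-embedding⁻¹ F π = record
  { injective = λ e → trans (sym (inverseʳ π)) (trans (cong (π ⟨$⟩ʳ_) e) (inverseʳ π))
  ; hom       = subst₂ (λ u v → adj F u v ≡ true) (sym (inverseʳ π)) (sym (inverseʳ π)) }

#injHom-relabel : ∀ {k n} (F : Graph k) (G : Graph n) π → #injHom (relabel F π) G ≡ #injHom F G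
#injHom-relabel F G π = ≤-antisym
  (#injHom-precompose G (π ⟨$⟩ʳ_) (relabel-embedding⁻¹ F π) (λ _ → inverseˡ π))
  (#injHom-precompose G (π ⟨$⟩ˡ_) (relabel-embedding F π) (λ _ → inverseʳ π))

-- Extending an embedding by a leaf

_∈ᵇ_ : ∀ {n k} → Fin n → Vec (Fin n) k → Bool
v ∈ᵇ []      = false
v ∈ᵇ (a ∷ g) = (v == a) ∨ (v ∈ᵇ g)

∈ᵇ⇒lookup : ∀ {n k} (v : Fin n) (g : Vec (Fin n) k) → (v ∈ᵇ g) ≡ true → ∃ λ i → lookup g i ≡ v
∈ᵇ⇒lookup v (a ∷ g) h with v ≟ a
... | yes v≡a = zero , sym v≡a
... | no _ with ∈ᵇ⇒lookup v g h
...   | i , e = suc i , e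

lookup⇒∈ᵇ : ∀ {n k} (g : Vec (Fin n) k) i → (lookup g i ∈ᵇ g) ≡ true
lookup⇒∈ᵇ (a ∷ g) zero    rewrite ==-refl a = refl
lookup⇒∈ᵇ (a ∷ g) (suc i) with lookup g i == a
... | true  = refl
... | false = lookup⇒∈ᵇ g i

∉-tail : ∀ {n k} (a : Fin n) (g : Vec (Fin n) k) → Injective _≡_ _≡_ (lookup (a ∷ g)) → (a ∈ᵇ g) ≡ false
∉-tail a g inj with a ∈ᵇ g in a∈g
... | false = refl
... | true with ∈ᵇ⇒lookup a g a∈g
...   | i , e with inj {zero} {suc i} (sym e)
...     | ()

image-size-≤ : ∀ {n k} (g : Vec (Fin n) k) → countFin n (_∈ᵇ g) ≤ k
image-size-≤ {n} []      = ≤-reflexive (countFin-false n)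
image-size-≤ {n} (a ∷ g) =
  ≤-trans (countFin-∨ n (_== a) (_∈ᵇ g)) (+-mono-≤ (countFin-== n a) (image-size-≤ g))

image-size-≥ : ∀ {n k} (g : Vec (Fin n) k) → Injective _≡_ _≡_ (lookup g) → k ≤ countFin n (_∈ᵇ g)
image-size-≥ {n} []      inj = z≤n
image-size-≥ {n} (a ∷ g) inj = begin
  suc _                      ≤⟨ s≤s (image-size-≥ g (suc-injective ∘ inj)) ⟩
  suc (countFin n (_∈ᵇ g))   ≤⟨ +-mono-≤ a-counted (≤-reflexive (countFin-cong n tail-size)) ⟩
  countFin n (λ v → (v ∈ᵇ (a ∷ g)) ∧ (v == a)) + countFin n (λ v → (v ∈ᵇ (a ∷ g)) ∧ not (v == a))
                             ≡⟨ countFin-split n (_∈ᵇ (a ∷ g)) (_== a) ⟨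
  countFin n (_∈ᵇ (a ∷ g))   ∎
  where
  open ≤-Reasoning
  a-counted : 1 ≤ countFin n (λ v → (v ∈ᵇ (a ∷ g)) ∧ (v == a))
  a-counted = countFin-pos n _ a (subst (λ b → (b ∨ (a ∈ᵇ g)) ∧ b ≡ true) (sym (==-refl a)) refl)
  tail-size : ∀ v → (v ∈ᵇ g) ≡ (v ∈ᵇ (a ∷ g)) ∧ not (v == a)
  tail-size v with v ≟ a
  ... | yes refl = ∉-tail a g inj
  ... | no _     = sym (∧-identityʳ (v ∈ᵇ g))

fresh-count-≥ : ∀ {n k} (g : Vec (Fin n) k) → n ∸ k ≤ countFin n (λ v → not (v ∈ᵇ g))
fresh-count-≥ {n} {k} g =
  subst (n ∸ k ≤_) (sym (countFin-not≡∸ n (_∈ᵇ g))) (∸-monoʳ-≤ n (image-size-≤ g))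

fresh-count-≤ : ∀ {n k} (g : Vec (Fin n) k) → Injective _≡_ _≡_ (lookup g) →
  countFin n (λ v → not (v ∈ᵇ g)) ≤ n ∸ k
fresh-count-≤ {n} {k} g inj =
  subst (_≤ n ∸ k) (sym (countFin-not≡∸ n (_∈ᵇ g))) (∸-monoʳ-≤ n (image-size-≥ g inj))

extend⁻ : ∀ {k n} {F : Graph (suc k)} {G : Graph n} {v g} →
  IsInjHom F G (lookup (v ∷ g)) → IsInjHom (deleteVertex F zero) G (lookup g) × (v ∈ᵇ g) ≡ false
extend⁻ {v = v} {g} h = record { injective = suc-injective ∘ injective h ; hom = hom h } , ∉-tail v g (injective h)

extend⁺ : ∀ {k n} {F : Graph (suc k)} {G : Graph n} {v g} →
  IsInjHom (deleteVertex F zero) G (lookup g) → (v ∈ᵇ g) ≡ false →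
  (∀ j → adj F zero (suc j) ≡ true → adj G v (lookup g j) ≡ true) → IsInjHom F G (lookup (v ∷ g))
extend⁺ {F = F} {G} {v} {g} h v∉g v-adj = record { injective = inj ; hom = hm }
  where
  inj : Injective _≡_ _≡_ (lookup (v ∷ g))
  inj {zero}  {zero}  _ = refl
  inj {zero}  {suc j} e = ⊥-elim (true≢false (subst (λ u → (u ∈ᵇ g) ≡ true) (sym e) (lookup⇒∈ᵇ g j)) v∉g)
  inj {suc i} {zero}  e = ⊥-elim (true≢false (subst (λ u → (u ∈ᵇ g) ≡ true) e (lookup⇒∈ᵇ g i)) v∉g)
  inj {suc i} {suc j} e = cong suc (injective h e)
  hm : ∀ {i j} → adj F i j ≡ true → adj G (lookup (v ∷ g) i) (lookup (v ∷ g) j) ≡ true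
  hm {zero}  {zero}  a = ⊥-elim (true≢false a (irrefl F zero))
  hm {zero}  {suc j} a = v-adj j a
  hm {suc i} {zero}  a = trans (Graph.sym G (lookup g i) v) (v-adj i (trans (Graph.sym F zero (suc i)) a))
  hm {suc i} {suc j} a = hom h a

degree : ∀ {n} → Graph n → Fin n → ℕ
degree {n} G u = countFin n (adj G u)

AtMostOneNeighbour : ∀ {k} → Graph k → Fin k → Set
AtMostOneNeighbour F u = ∀ {j j′} → adj F u j ≡ true → adj F u j′ ≡ true → j ≡ j′

fresh-neighbours-≥ : ∀ {m k} (H : Graph m) (g : Vec (Fin m) k) {u} → (u ∈ᵇ g) ≡ true →
  suc (degree H u) ≤ k + countFin m (λ v → adj H u v ∧ not (v ∈ᵇ g))
fresh-neighbours-≥ {m} {k} H g {u} u∈g = begin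
  suc (degree H u)            ≡⟨ cong suc (countFin-split m (adj H u) (_∈ᵇ g)) ⟩
  suc (countFin m (λ v → adj H u v ∧ (v ∈ᵇ g)) + Y)
                              ≤⟨ +-monoˡ-≤ Y (s≤s (countFin-mono m adjacent⇒≢u)) ⟩
  suc (countFin m (λ v → (v ∈ᵇ g) ∧ not (v == u))) + Y
                              ≤⟨ +-monoˡ-≤ Y (+-monoˡ-≤ _ (countFin-pos m _ u (∧-intro u∈g (==-refl u)))) ⟩
  (countFin m (λ v → (v ∈ᵇ g) ∧ (v == u)) + countFin m (λ v → (v ∈ᵇ g) ∧ not (v == u))) + Y
                              ≡⟨ cong (_+ Y) (countFin-split m (_∈ᵇ g) (_== u)) ⟨
  countFin m (_∈ᵇ g) + Y      ≤⟨ +-monoˡ-≤ Y (image-size-≤ g) ⟩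
  k + Y                       ∎
  where
  open ≤-Reasoning
  Y = countFin m (λ v → adj H u v ∧ not (v ∈ᵇ g))
  adjacent⇒≢u : ∀ v → (adj H u v ∧ (v ∈ᵇ g)) ≡ true → ((v ∈ᵇ g) ∧ not (v == u)) ≡ true
  adjacent⇒≢u v h with v ≟ u
  ... | yes refl = ⊥-elim (true≢false (∧-conicalˡ _ _ h) (irrefl H u))
  ... | no _     = ∧-intro (∧-conicalʳ _ _ h) refl

#extensions : ∀ {k n} → Graph (suc k) → Graph n → Vec (Fin n) k → ℕ
#extensions {n = n} F G g = countFin n (λ v → isInjHom F G (v ∷ g))

#injHom-suc : ∀ {k n} (F : Graph (suc k)) (G : Graph n) → #injHom F G ≡ sumList (allMaps k n) (#extensions F G)
#injHom-suc {k} {n} F G = count-allMaps-suc k n (isInjHom F G)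

#extensions-≤ : ∀ {k n} (F : Graph (suc k)) (G : Graph n) (g : Vec (Fin n) k) →
  #extensions F G g ≤ ind (isInjHom (deleteVertex F zero) G g) * (n ∸ k)
#extensions-≤ {k} {n} F G g with isInjHom (deleteVertex F zero) G g in g-hom
... | false = ≤-trans (countFin-mono n no-extension) (≤-reflexive (countFin-false n))
  where
  no-extension : ∀ v → isInjHom F G (v ∷ g) ≡ true → false ≡ true
  no-extension v h =
    trans (sym g-hom) (IsInjHom⇒isInjHom _ G g (proj₁ (extend⁻ (isInjHom⇒IsInjHom F G (v ∷ g) h))))
... | true = begin
  #extensions F G g                ≤⟨ countFin-mono n extension⇒fresh ⟩
  countFin n (λ v → not (v ∈ᵇ g))  ≤⟨ fresh-count-≤ g (injective g-injHom) ⟩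
  n ∸ k                            ≡⟨ +-identityʳ (n ∸ k) ⟨
  1 * (n ∸ k)                      ∎
  where
  open ≤-Reasoning
  g-injHom = isInjHom⇒IsInjHom (deleteVertex F zero) G g g-hom
  extension⇒fresh : ∀ v → isInjHom F G (v ∷ g) ≡ true → not (v ∈ᵇ g) ≡ true
  extension⇒fresh v h = cong not (proj₂ (extend⁻ (isInjHom⇒IsInjHom F G (v ∷ g) h)))

#extensions-≥ : ∀ {k m} c (F : Graph (suc k)) (H : Graph m) → AtMostOneNeighbour F zero →
  (∀ u → c ≤ degree H u) → suc c ≤ m → (g : Vec (Fin m) k) →
  ind (isInjHom (deleteVertex F zero) H g) * (suc c ∸ k) ≤ #extensions F H g
#extensions-≥ {k} {m} c F H leaf minDeg c<m g with isInjHom (deleteVertex F zero) H g in g-hom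
... | false = z≤n
... | true with any? (λ j → adj F zero (suc j) ≟ᵇ true)
...   | no isolated = begin
  1 * (suc c ∸ k)                  ≡⟨ +-identityʳ (suc c ∸ k) ⟩
  suc c ∸ k                        ≤⟨ ∸-monoˡ-≤ k c<m ⟩
  m ∸ k                            ≤⟨ fresh-count-≥ g ⟩
  countFin m (λ v → not (v ∈ᵇ g))  ≤⟨ countFin-mono m fresh⇒extension ⟩
  #extensions F H g                ∎
  where
  open ≤-Reasoning
  g-injHom = isInjHom⇒IsInjHom (deleteVertex F zero) H g g-hom
  fresh⇒extension : ∀ v → not (v ∈ᵇ g) ≡ true → isInjHom F H (v ∷ g) ≡ true
  fresh⇒extension v v∉g = IsInjHom⇒isInjHom F H (v ∷ g)
    (extend⁺ g-injHom (not-injective v∉g) (λ j a → ⊥-elim (isolated (j , a))))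
...   | yes (p , a₀) = begin
  1 * (suc c ∸ k)                  ≡⟨ +-identityʳ (suc c ∸ k) ⟩
  suc c ∸ k                        ≤⟨ m≤n+o⇒m∸n≤o (suc c) k
                                       (≤-trans (s≤s (minDeg u)) (fresh-neighbours-≥ H g (lookup⇒∈ᵇ g p))) ⟩
  countFin m (λ v → adj H u v ∧ not (v ∈ᵇ g)) ≤⟨ countFin-mono m fresh-neighbour⇒extension ⟩
  #extensions F H g                ∎
  where
  open ≤-Reasoning
  g-injHom = isInjHom⇒IsInjHom (deleteVertex F zero) H g g-hom
  u = lookup g p
  fresh-neighbour⇒extension : ∀ v → (adj H u v ∧ not (v ∈ᵇ g)) ≡ true → isInjHom F H (v ∷ g) ≡ true
  fresh-neighbour⇒extension v h = IsInjHom⇒isInjHom F H (v ∷ g)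
    (extend⁺ g-injHom (not-injective (∧-conicalʳ _ _ h)) v-adj)
    where
    v-adj : ∀ j → adj F zero (suc j) ≡ true → adj H v (lookup g j) ≡ true
    v-adj j a with leaf a a₀
    ... | refl = trans (Graph.sym H v u) (∧-conicalˡ _ _ h)

#injHom-extend-leaf : ∀ {k m} c (F : Graph (suc k)) (H : Graph m) → AtMostOneNeighbour F zero →
  (∀ u → c ≤ degree H u) → suc c ≤ m →
  #injHom (deleteVertex F zero) (complete (suc c)) ≤ #injHom (deleteVertex F zero) H →
  #injHom F (complete (suc c)) ≤ #injHom F H
#injHom-extend-leaf {k} {m} c F H leaf minDeg c<m ih = begin
  #injHom F K
    ≡⟨ #injHom-suc F K ⟩
  sumList (allMaps k (suc c)) (#extensions F K)
    ≤⟨ sumList-mono (allMaps k (suc c)) (#extensions-≤ F K) ⟩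
  sumList (allMaps k (suc c)) (λ g → ind (isInjHom F₀ K g) * (suc c ∸ k))
    ≡⟨ sumList-ind-* (allMaps k (suc c)) (isInjHom F₀ K) (suc c ∸ k) ⟩
  #injHom F₀ K * (suc c ∸ k)
    ≤⟨ *-monoˡ-≤ (suc c ∸ k) ih ⟩
  #injHom F₀ H * (suc c ∸ k)
    ≡⟨ sumList-ind-* (allMaps k m) (isInjHom F₀ H) (suc c ∸ k) ⟨
  sumList (allMaps k m) (λ g → ind (isInjHom F₀ H g) * (suc c ∸ k))
    ≤⟨ sumList-mono (allMaps k m) (#extensions-≥ c F H leaf minDeg c<m) ⟩
  sumList (allMaps k m) (#extensions F H)
    ≡⟨ #injHom-suc F H ⟨
  #injHom F H ∎
  where
  open ≤-Reasoning
  K  = complete (suc c)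
  F₀ = deleteVertex F zero

-- Forests

TwoNeighbours : ∀ {K} → Graph K → Fin K → Set
TwoNeighbours F c = ∃ λ j → ∃ λ j′ → adj F c j ≡ true × adj F c j′ ≡ true × j ≢ j′

twoNeighbours? : ∀ {K} (F : Graph K) c → Dec (TwoNeighbours F c)
twoNeighbours? F c =
  any? λ j → any? λ j′ → (adj F c j ≟ᵇ true) ×-dec ((adj F c j′ ≟ᵇ true) ×-dec ¬? (j ≟ j′))

module NonBacktrackingWalk {K : ℕ} (F : Graph K) (two : ∀ c → TwoNeighbours F c) (start : Fin K) where

  n₁ n₂ : Fin K → Fin K
  n₁ c = proj₁ (two c)
  n₂ c = proj₁ (proj₂ (two c))

  adj₁ : ∀ c → adj F c (n₁ c) ≡ true
  adj₁ c = proj₁ (proj₂ (proj₂ (two c)))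

  adj₂ : ∀ c → adj F c (n₂ c) ≡ true
  adj₂ c = proj₁ (proj₂ (proj₂ (proj₂ (two c))))

  n₁≢n₂ : ∀ c → n₁ c ≢ n₂ c
  n₁≢n₂ c = proj₂ (proj₂ (proj₂ (proj₂ (two c))))

  next : Fin K → Fin K → Fin K
  next p c with n₁ c ≟ p
  ... | yes _ = n₂ c
  ... | no _  = n₁ c

  next-adj : ∀ p c → adj F c (next p c) ≡ true
  next-adj p c with n₁ c ≟ p
  ... | yes _ = adj₂ c
  ... | no _  = adj₁ c

  next-≢ : ∀ p c → next p c ≢ p
  next-≢ p c with n₁ c ≟ p
  ... | yes n₁≡p = λ n₂≡p → n₁≢n₂ c (trans n₁≡p (sym n₂≡p))
  ... | no n₁≢p  = n₁≢p

  steps : ℕ → Fin K × Fin K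
  steps zero    = start , n₁ start
  steps (suc t) = proj₂ (steps t) , next (proj₁ (steps t)) (proj₂ (steps t))

  walk : ℕ → Fin K
  walk t = proj₁ (steps t)

  walk-adj : ∀ t → adj F (walk t) (walk (suc t)) ≡ true
  walk-adj zero    = adj₁ start
  walk-adj (suc t) = next-adj (proj₁ (steps t)) (proj₂ (steps t))

  walk-no-backtrack : ∀ t → walk (suc (suc t)) ≢ walk t
  walk-no-backtrack t = next-≢ (proj₁ (steps t)) (proj₂ (steps t))

  Revisits : ℕ → Set
  Revisits j = ∃ λ i → i < j × walk i ≡ walk j

  revisits? : ∀ j → Dec (Revisits j)
  revisits? j with any? (λ (x : Fin j) → walk (toℕ x) ≟ walk j)
  ... | yes (x , e) = yes (toℕ x , toℕ<n x , e)
  ... | no none     = no λ { (i , i<j , e) → none (fromℕ< i<j , trans (cong walk (toℕ-fromℕ< i<j)) e) }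

  -- Between the first revisit and its earlier visit the walk is a path, and the closing
  -- segment has length ≥ 3 because the walk has no loops and never backtracks.
  first-revisit⇒cycle : ∀ i j → i < j → walk i ≡ walk j → (∀ j′ → j′ < j → ¬ Revisits j′) → Cycle F
  first-revisit⇒cycle i j i<j e first with j ∸ i | m+[n∸m]≡n (<⇒≤ i<j)
  ... | zero | i+0≡j = ⊥-elim (<⇒≢ i<j (trans (sym (+-identityʳ i)) i+0≡j))
  ... | suc zero | refl =
    ⊥-elim (true≢false (walk-adj i)
      (subst (λ z → adj F (walk i) z ≡ false) (trans e (cong walk (+-comm i 1))) (irrefl F (walk i))))
  ... | suc (suc zero) | refl = ⊥-elim (walk-no-backtrack i (sym (trans e (cong walk (+-comm i 2)))))
  ... | suc (suc (suc l)) | refl =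
    record { m = l ; f = f ; inj = λ {x} {y} → f-inj x y ; step = step ; close = close }
    where
    f : Fin (suc (suc (suc l))) → Fin K
    f x = walk (i + toℕ x)
    f-inj : ∀ x y → f x ≡ f y → x ≡ y
    f-inj x y q with <-cmp (toℕ x) (toℕ y)
    ... | tri≈ _ x≡y _ = toℕ-injective x≡y
    ... | tri< x<y _ _ = ⊥-elim (first (i + toℕ y) (+-monoʳ-< i (toℕ<n y)) (i + toℕ x , +-monoʳ-< i x<y , q))
    ... | tri> _ _ y<x = ⊥-elim (first (i + toℕ x) (+-monoʳ-< i (toℕ<n x)) (i + toℕ y , +-monoʳ-< i y<x , sym q))
    step : ∀ (x : Fin (suc (suc l))) → adj F (f (inject₁ x)) (f (suc x)) ≡ true
    step x rewrite toℕ-inject₁ x | +-suc i (toℕ x) = walk-adj (i + toℕ x)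
    close : adj F (f (fromℕ (suc (suc l)))) (f zero) ≡ true
    close rewrite toℕ-fromℕ (suc (suc l)) | +-identityʳ i =
      subst (λ z → adj F (walk (i + suc (suc l))) z ≡ true)
            (sym (trans e (cong walk (+-suc i (suc (suc l)))))) (walk-adj (i + suc (suc l)))

  some-revisit : ¬ (∀ (x : Fin (suc K)) → ¬ Revisits (toℕ x))
  some-revisit none = let x , y , x<y , e = pigeonhole ≤-refl (walk ∘ toℕ) in none y (toℕ x , x<y , e)

  cycle : Cycle F
  cycle =
    let j , revisit , earlier = ¬∀⟶∃¬-smallest (suc K) _ (λ x → ¬? (revisits? (toℕ x))) some-revisit
        i , i<j , e = decidable-stable (revisits? (toℕ j)) revisit
    in first-revisit⇒cycle i (toℕ j) i<j e λ j′ j′<j →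
         subst (¬_ ∘ Revisits) (trans (toℕ-inject (fromℕ< j′<j)) (toℕ-fromℕ< j′<j)) (earlier (fromℕ< j′<j))

forest-has-leaf : ∀ {k} (F : Graph (suc k)) → IsForest F → ∃ (AtMostOneNeighbour F)
forest-has-leaf {k} F forest with all? (twoNeighbours? F)
... | yes two = ⊥-elim (forest (NonBacktrackingWalk.cycle F two zero))
... | no ¬two with ¬∀⟶∃¬ (suc k) (TwoNeighbours F) (twoNeighbours? F) ¬two
...   | c , ¬two-c = c , at-most-one
  where
  at-most-one : AtMostOneNeighbour F c
  at-most-one {j} {j′} a a′ with j ≟ j′
  ... | yes j≡j′ = j≡j′
  ... | no j≢j′  = ⊥-elim (¬two-c (j , j′ , a , a′ , j≢j′))

#injHom-forest : ∀ k (F : Graph k) → IsForest F → ∀ {c m} (H : Graph m) →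
  (∀ u → c ≤ degree H u) → suc c ≤ m → #injHom F (complete (suc c)) ≤ #injHom F H
#injHom-forest zero    F _      H _      _   = ≤-refl   -- both sides count only the empty map
#injHom-forest (suc k) F forest {c} H minDeg c<m = begin
  #injHom F  (complete (suc c)) ≡⟨ #injHom-relabel F (complete (suc c)) π ⟨
  #injHom F′ (complete (suc c)) ≤⟨ #injHom-extend-leaf c F′ H leaf′ minDeg c<m
                                     (#injHom-forest k F′₀ F′₀-forest H minDeg c<m) ⟩
  #injHom F′ H                  ≡⟨ #injHom-relabel F H π ⟩
  #injHom F  H                  ∎
  where
  open ≤-Reasoning
  ℓ  = proj₁ (forest-has-leaf F forest)
  π  = transpose zero ℓ
  F′ = relabel F π
  F′₀ = deleteVertex F′ zero
  F′₀-forest : IsForest F′₀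
  F′₀-forest = IsInjHom⇒forest (deleteVertex-embedding F′ zero)
                 (IsInjHom⇒forest (relabel-embedding F π) forest)
  leaf′ : AtMostOneNeighbour F′ zero
  leaf′ a a′ = injective (relabel-embedding F π) (proj₂ (forest-has-leaf F forest) a a′)

-- Colourings and cores

Colouring : ∀ {n} → Graph n → ℕ → Set
Colouring {n} G c = Σ (Fin n → Fin c) λ col → ∀ {i j} → adj G i j ≡ true → col i ≢ col j

record Core {n} (G : Graph n) (c : ℕ) : Set where
  field
    {size}      : ℕ
    graph       : Graph size
    embedding   : Fin size → Fin n
    isEmbedding : IsInjHom graph G embedding
    minDegree   : ∀ u → c ≤ degree graph u
    vertex      : Fin size

module _ {n N c} (col : Fin n → Fin c) (e : Fin n → Fin N) (p : Fin N → Bool) where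

  private
    used? : ∀ x j → Dec (p (e j) ≡ true × col j ≡ x)
    used? x j = (p (e j) ≟ᵇ true) ×-dec (col j ≟ x)

  free-colour : Injective _≡_ _≡_ e → countFin N p < c → ∃ λ x → ∀ j → p (e j) ≡ true → col j ≢ x
  free-colour e-inj p<c with any? (λ x → all? (λ j → ¬? (used? x j)))
  ... | yes (x , free) = x , λ j pj colj≡x → free j (pj , colj≡x)
  ... | no ¬free = ⊥-elim (<⇒≱ p<c (countFin-≥-injection (e ∘ witness) p (witness-inj ∘ e-inj) (proj₁ ∘ witness-ok)))
    where
    witness-exists : ∀ x → ∃ λ j → p (e j) ≡ true × col j ≡ x
    witness-exists x with ¬∀⟶∃¬ n _ (λ j → ¬? (used? x j)) (λ h → ¬free (x , h))
    ... | j , ¬¬used = j , decidable-stable (used? x j) ¬¬used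
    witness : Fin c → Fin n
    witness = proj₁ ∘ witness-exists
    witness-ok : ∀ x → p (e (witness x)) ≡ true × col (witness x) ≡ x
    witness-ok = proj₂ ∘ witness-exists
    witness-inj : Injective _≡_ _≡_ witness
    witness-inj {x} {y} eq = trans (sym (proj₂ (witness-ok x))) (trans (cong col eq) (proj₂ (witness-ok y)))

extend-colouring : ∀ {n c} (G : Graph (suc n)) u (col : Fin n → Fin c) →
  (∀ {i j} → adj (deleteVertex G u) i j ≡ true → col i ≢ col j) →
  (x : Fin c) → (∀ j → adj G u (punchIn u j) ≡ true → col j ≢ x) → Colouring G c
extend-colouring G u col proper x x-free = col′ , proper′
  where
  col′ : Fin _ → Fin _
  col′ v with v ≟ u
  ... | yes _   = x
  ... | no v≢u = col (punchOut (v≢u ∘ sym))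
  adj-u : ∀ {v} (u≢v : u ≢ v) → adj G u v ≡ true → adj G u (punchIn u (punchOut u≢v)) ≡ true
  adj-u u≢v = subst (λ w → adj G u w ≡ true) (sym (punchIn-punchOut u≢v))
  proper′ : ∀ {i j} → adj G i j ≡ true → col′ i ≢ col′ j
  proper′ {i} {j} a with i ≟ u | j ≟ u
  ... | yes refl | yes refl = ⊥-elim (true≢false a (irrefl G i))
  ... | yes refl | no j≢u  = x-free _ (adj-u (j≢u ∘ sym) a) ∘ sym
  ... | no i≢u  | yes refl = x-free _ (adj-u (i≢u ∘ sym) (trans (Graph.sym G j i) a))
  ... | no i≢u  | no j≢u  = proper (subst₂ (λ v w → adj G v w ≡ true)
                                      (sym (punchIn-punchOut (i≢u ∘ sym))) (sym (punchIn-punchOut (j≢u ∘ sym))) a)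

Core-transport : ∀ {n n′ c} {G : Graph n} {G′ : Graph n′} {e : Fin n → Fin n′} →
  IsInjHom G G′ e → Core G c → Core G′ c
Core-transport {e = e} he core = record
  { graph = graph ; embedding = e ∘ embedding ; isEmbedding = IsInjHom-∘ he isEmbedding
  ; minDegree = minDegree ; vertex = vertex }
  where open Core core

colouring-or-core : ∀ n (G : Graph n) c → Colouring G c ⊎ Core G c
colouring-or-core zero    G c = inj₁ ((λ ()) , λ { {()} })
colouring-or-core (suc n) G c with any? (λ u → degree G u <? c)
... | no ¬low = inj₂ record
  { graph = G ; embedding = λ v → v ; isEmbedding = IsInjHom-id G
  ; minDegree = λ u → ≮⇒≥ (¬low ∘ (u ,_)) ; vertex = zero }
... | yes (u , low) with colouring-or-core n (deleteVertex G u) c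
...   | inj₂ core = inj₂ (Core-transport (deleteVertex-embedding G u) core)
...   | inj₁ (col , proper) with free-colour col (punchIn u) (adj G u) (punchIn-injective u _ _) low
...     | x , free = inj₁ (extend-colouring G u col proper x free)

Core-size : ∀ {n c} {G : Graph n} (core : Core G c) → suc c ≤ Core.size core
Core-size core = ≤-trans (s≤s (minDegree vertex))
  (countFin-<-size size (adj graph vertex) vertex (irrefl graph vertex))
  where open Core core

Colouring⇒KtRamsey-complete : ∀ {n} t (G : Graph n) c → Colouring G c → KtRamsey t G → KtRamsey t (complete c)
Colouring⇒KtRamsey-complete t G c (col , proper) ramsey χ χ-sym
  with ramsey (λ i j → χ (col i) (col j)) (λ i j → χ-sym (col i) (col j))
... | b , f , f-inj , mono = b , col ∘ f , col∘f-inj , λ i j i≢j → distinct i j i≢j , proj₂ (mono i j i≢j)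
  where
  distinct : ∀ i j → i ≢ j → not (col (f i) == col (f j)) ≡ true
  distinct i j i≢j = cong not (≢⇒==-false (proper (proj₁ (mono i j i≢j))))
  col∘f-inj : Injective _≡_ _≡_ (col ∘ f)
  col∘f-inj {i} {j} e with i ≟ j
  ... | yes i≡j = i≡j
  ... | no i≢j  = ⊥-elim (proper (proj₁ (mono i j i≢j)) e)

¬KtRamsey-empty : ∀ t → ¬ KtRamsey (suc t) (complete 0)
¬KtRamsey-empty t ramsey with ramsey (λ _ _ → true) (λ _ _ → refl)
... | _ , f , _ with f zero
...   | ()

-- Copies and automorphisms

VertexImage : ∀ {k n} → Vec (Fin n) k → Fin n → Set
VertexImage f v = ∃ λ i → lookup f i ≡ v

EdgeImage : ∀ {k n} → Graph k → Vec (Fin n) k → Fin n → Fin n → Set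
EdgeImage F f u v = ∃ λ i → ∃ λ j → adj F i j ≡ true × lookup f i ≡ u × lookup f j ≡ v

vertexImageᵇ : ∀ {k n} → Vec (Fin n) k → Fin n → Bool
vertexImageᵇ {k} f v = any (λ i → lookup f i == v) (allFin k)

edgeImageᵇ : ∀ {k n} → Graph k → Vec (Fin n) k → Fin n → Fin n → Bool
edgeImageᵇ {k} F f u v =
  any (λ i → any (λ j → adj F i j ∧ (lookup f i == u) ∧ (lookup f j == v)) (allFin k)) (allFin k)

vertexImageᵇ⇔ : ∀ {k n} (f : Vec (Fin n) k) v → vertexImageᵇ f v ≡ true ⇔ VertexImage f v
vertexImageᵇ⇔ f v = mk⇔
  (λ h → let i , e = any-allFin⁻ _ h in i , ==⇒≡ e)
  (λ { (i , refl) → any-allFin⁺ _ i (==-refl (lookup f i)) })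

edgeImageᵇ⇔ : ∀ {k n} (F : Graph k) (f : Vec (Fin n) k) u v → edgeImageᵇ F f u v ≡ true ⇔ EdgeImage F f u v
edgeImageᵇ⇔ F f u v = mk⇔
  (λ h → let i , h′ = any-allFin⁻ _ h
             j , c  = any-allFin⁻ _ h′
             c′     = ∧-conicalʳ (adj F i j) _ c
         in i , j , ∧-conicalˡ _ _ c , ==⇒≡ (∧-conicalˡ _ _ c′) , ==⇒≡ (∧-conicalʳ _ _ c′))
  (λ { (i , j , a , refl , refl) →
         any-allFin⁺ _ i (any-allFin⁺ _ j (∧-intro a (∧-intro (==-refl (lookup f i)) (==-refl (lookup f j))))) })

module _ {k n} {F : Graph k} (f g : Vec (Fin n) k) where
  open Equivalence

  image-≡⇒VertexImage : image F f ≡ image F g → ∀ {v} → VertexImage f v → VertexImage g v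
  image-≡⇒VertexImage eq {v} = to (vertexImageᵇ⇔ g v) ∘ transport ∘ from (vertexImageᵇ⇔ f v)
    where
    entry : ∀ h → lookup (proj₁ (image F h)) v ≡ vertexImageᵇ h v
    entry h = lookup∘tabulate _ v
    transport : vertexImageᵇ f v ≡ true → vertexImageᵇ g v ≡ true
    transport h = trans (sym (entry g)) (trans (cong (λ S → lookup (proj₁ S) v) (sym eq)) (trans (entry f) h))

  image-≡⇒EdgeImage : image F f ≡ image F g → ∀ {u v} → EdgeImage F f u v → EdgeImage F g u v
  image-≡⇒EdgeImage eq {u} {v} = to (edgeImageᵇ⇔ F g u v) ∘ transport ∘ from (edgeImageᵇ⇔ F f u v)
    where
    entry : ∀ h → lookup (lookup (proj₂ (image F h)) u) v ≡ edgeImageᵇ F h u v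
    entry h = trans (cong (λ row → lookup row v) (lookup∘tabulate _ u)) (lookup∘tabulate _ v)
    transport : edgeImageᵇ F f u v ≡ true → edgeImageᵇ F g u v ≡ true
    transport h =
      trans (sym (entry g)) (trans (cong (λ S → lookup (lookup (proj₂ S) u) v) (sym eq)) (trans (entry f) h))

  image-≡ : (∀ {v} → VertexImage f v → VertexImage g v) → (∀ {v} → VertexImage g v → VertexImage f v) →
    (∀ {u v} → EdgeImage F f u v → EdgeImage F g u v) → (∀ {u v} → EdgeImage F g u v → EdgeImage F f u v) →
    image F f ≡ image F g
  image-≡ V⊆ V⊇ E⊆ E⊇ = cong₂ _,_
    (tabulate-cong λ v → bool-ext (from (vertexImageᵇ⇔ g v) ∘ V⊆ ∘ to (vertexImageᵇ⇔ f v))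
                                  (from (vertexImageᵇ⇔ f v) ∘ V⊇ ∘ to (vertexImageᵇ⇔ g v)))
    (tabulate-cong λ u → tabulate-cong λ v →
      bool-ext (from (edgeImageᵇ⇔ F g u v) ∘ E⊆ ∘ to (edgeImageᵇ⇔ F f u v))
               (from (edgeImageᵇ⇔ F f u v) ∘ E⊇ ∘ to (edgeImageᵇ⇔ F g u v)))

record IsAut {k} (F : Graph k) (σ : Fin k → Fin k) : Set where
  field
    injHom   : IsInjHom F F σ
    reflects : ∀ {i j} → adj F (σ i) (σ j) ≡ true → adj F i j ≡ true

reflectsᵇ : ∀ {k} → Graph k → Vec (Fin k) k → Bool
reflectsᵇ {k} F σ = all (λ i → all (λ j → not (adj F (lookup σ i) (lookup σ j)) ∨ adj F i j) (allFin k)) (allFin k)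

isAut : ∀ {k} → Graph k → Vec (Fin k) k → Bool
isAut F σ = isInjHom F F σ ∧ reflectsᵇ F σ

isAut⇒IsAut : ∀ {k} (F : Graph k) σ → isAut F σ ≡ true → IsAut F (lookup σ)
isAut⇒IsAut F σ h = record
  { injHom   = isInjHom⇒IsInjHom F F σ (∧-conicalˡ _ _ h)
  ; reflects = λ {i} {j} → not∨-elim (all-allFin⁻ _ (all-allFin⁻ _ (∧-conicalʳ (isInjHom F F σ) _ h) i) j) }

IsAut⇒isAut : ∀ {k} (F : Graph k) σ → IsAut F (lookup σ) → isAut F σ ≡ true
IsAut⇒isAut F σ h = ∧-intro (IsInjHom⇒isInjHom F F σ (IsAut.injHom h))
  (all-allFin⁺ _ λ i → all-allFin⁺ _ λ j → not∨-intro _ _ (IsAut.reflects h {i} {j}))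

auts : ∀ {k} → Graph k → List (Vec (Fin k) k)
auts {k} F = filterᵇ (isAut F) (allMaps k k)

#aut : ∀ {k} → Graph k → ℕ
#aut F = length (auts F)

∈-auts⁺ : ∀ {k} (F : Graph k) σ → IsAut F (lookup σ) → σ ∈ auts F
∈-auts⁺ F σ h = ∈-filter⁺ (T? ∘ isAut F) (∈-allMaps _ _ σ) (Equivalence.from T-≡ (IsAut⇒isAut F σ h))

∈-auts⁻ : ∀ {k} (F : Graph k) {σ} → σ ∈ auts F → IsAut F (lookup σ)
∈-auts⁻ F {σ} σ∈ = isAut⇒IsAut F σ (Equivalence.to T-≡ (proj₂ (∈-filter⁻ (T? ∘ isAut F) {xs = allMaps _ _} σ∈)))

auts-unique : ∀ {k} (F : Graph k) → Unique (auts F)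
auts-unique F = filter⁺ (T? ∘ isAut F) (allMaps-unique _ _)

#aut-pos : ∀ {k} (F : Graph k) → 1 ≤ #aut F
#aut-pos {k} F with auts F | ∈-auts⁺ F (tabulateᵛ (λ i → i)) id-aut
  where
  id-aut : IsAut F (lookup (tabulateᵛ (λ i → i)))
  id-aut = record
    { injHom   = IsInjHom-cong (λ i → sym (lookup∘tabulate (λ i → i) i)) (IsInjHom-id F)
    ; reflects = λ {i} {j} →
        subst₂ (λ u v → adj F u v ≡ true) (lookup∘tabulate (λ i → i) i) (lookup∘tabulate (λ i → i) j) }
... | _ ∷ _ | _ = s≤s z≤n

_∘ᵛ_ : ∀ {k n} → Vec (Fin n) k → Vec (Fin k) k → Vec (Fin n) k
f ∘ᵛ σ = tabulateᵛ (lookup f ∘ lookup σ)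

lookup-∘ᵛ : ∀ {k n} (f : Vec (Fin n) k) σ i → lookup (f ∘ᵛ σ) i ≡ lookup f (lookup σ i)
lookup-∘ᵛ f σ = lookup∘tabulate (lookup f ∘ lookup σ)

∘ᵛ-injHom : ∀ {k n} {F : Graph k} {G : Graph n} {f σ} →
  IsInjHom F G (lookup f) → IsAut F (lookup σ) → IsInjHom F G (lookup (f ∘ᵛ σ))
∘ᵛ-injHom {f = f} {σ} hf hσ = IsInjHom-cong (sym ∘ lookup-∘ᵛ f σ) (IsInjHom-∘ hf (IsAut.injHom hσ))

image-∘ᵛ : ∀ {k n} (F : Graph k) (f : Vec (Fin n) k) σ → IsAut F (lookup σ) → image F (f ∘ᵛ σ) ≡ image F f
image-∘ᵛ F f σ hσ = image-≡ {F = F} (f ∘ᵛ σ) f V⊆ V⊇ E⊆ E⊇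
  where
  open IsAut hσ
  preimage = injective⇒surjective (lookup σ) (injective injHom)
  V⊆ : ∀ {v} → VertexImage (f ∘ᵛ σ) v → VertexImage f v
  V⊆ (i , e) = lookup σ i , trans (sym (lookup-∘ᵛ f σ i)) e
  V⊇ : ∀ {v} → VertexImage f v → VertexImage (f ∘ᵛ σ) v
  V⊇ (i , e) = let i′ , σi′≡i = preimage i in
    i′ , trans (lookup-∘ᵛ f σ i′) (trans (cong (lookup f) σi′≡i) e)
  E⊆ : ∀ {u v} → EdgeImage F (f ∘ᵛ σ) u v → EdgeImage F f u v
  E⊆ (i , j , a , p , q) =
    lookup σ i , lookup σ j , hom injHom a , trans (sym (lookup-∘ᵛ f σ i)) p , trans (sym (lookup-∘ᵛ f σ j)) q
  E⊇ : ∀ {u v} → EdgeImage F f u v → EdgeImage F (f ∘ᵛ σ) u v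
  E⊇ (i , j , a , p , q) = let i′ , σi′≡i = preimage i ; j′ , σj′≡j = preimage j in
    i′ , j′ , reflects (subst₂ (λ x y → adj F x y ≡ true) (sym σi′≡i) (sym σj′≡j) a) ,
    trans (lookup-∘ᵛ f σ i′) (trans (cong (lookup f) σi′≡i) p) ,
    trans (lookup-∘ᵛ f σ j′) (trans (cong (lookup f) σj′≡j) q)

transition : ∀ {k n} → Vec (Fin n) k → Vec (Fin n) k → Vec (Fin k) k
transition {k} f g = tabulateᵛ (λ i → find-or (λ j → lookup f j == lookup g i) (allFin k) i)

module Transition {k n} {F : Graph k} {G : Graph n} {f g : Vec (Fin n) k}
  (hf : IsInjHom F G (lookup f)) (hg : IsInjHom F G (lookup g)) (same-image : image F f ≡ image F g) where

  σ : Vec (Fin k) k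
  σ = transition f g

  f∘σ : ∀ i → lookup f (lookup σ i) ≡ lookup g i
  f∘σ i = let j , fj≡gi = image-≡⇒VertexImage {F = F} g f (sym same-image) (i , refl) in
    trans (cong (lookup f) (lookup∘tabulate _ i))
      (==⇒≡ (proj₁ (find-or-satisfies (λ j → lookup f j == lookup g i) (allFin k) i (∈-allFin j) (≡⇒== fj≡gi))))

  σ-aut : IsAut F (lookup σ)
  σ-aut = record
    { injHom   = record { injective = injective hg ∘ σ-inj ; hom = σ-hom }
    ; reflects = σ-reflects }
    where
    σ-inj : ∀ {i j} → lookup σ i ≡ lookup σ j → lookup g i ≡ lookup g j
    σ-inj {i} {j} e = trans (sym (f∘σ i)) (trans (cong (lookup f) e) (f∘σ j))
    σ-hom : ∀ {i j} → adj F i j ≡ true → adj F (lookup σ i) (lookup σ j) ≡ true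
    σ-hom {i} {j} a =
      let i′ , j′ , a′ , p , q = image-≡⇒EdgeImage {F = F} g f (sym same-image) (i , j , a , refl , refl) in
      subst₂ (λ x y → adj F x y ≡ true)
        (injective hf (trans p (sym (f∘σ i)))) (injective hf (trans q (sym (f∘σ j)))) a′
    σ-reflects : ∀ {i j} → adj F (lookup σ i) (lookup σ j) ≡ true → adj F i j ≡ true
    σ-reflects {i} {j} a =
      let i′ , j′ , a′ , p , q =
            image-≡⇒EdgeImage {F = F} f g same-image (lookup σ i , lookup σ j , a , f∘σ i , f∘σ j) in
      subst₂ (λ x y → adj F x y ≡ true) (injective hg p) (injective hg q) a′

  g≡f∘ᵛσ : g ≡ f ∘ᵛ σ
  g≡f∘ᵛσ = Pointwise-≡⇒≡ (ext λ i → sym (trans (lookup-∘ᵛ f σ i) (f∘σ i)))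

module OrbitCounting {k n} (F : Graph k) (G : Graph n) where

  L = injHoms F G
  D = deduplicate subgraph-≟ (map (image F) L)
  A = auts F

  hasImage : Subgraph n → Vec (Fin n) k → Bool
  hasImage S h = ⌊ subgraph-≟ (image F h) S ⌋

  hasImage⁺ : ∀ {S h} → image F h ≡ S → hasImage S h ≡ true
  hasImage⁺ {S} {h} e with subgraph-≟ (image F h) S
  ... | yes _  = refl
  ... | no ≢S = ⊥-elim (≢S e)

  hasImage⁻ : ∀ {S h} → hasImage S h ≡ true → image F h ≡ S
  hasImage⁻ {S} {h} e with subgraph-≟ (image F h) S
  ... | yes ≡S = ≡S
  hasImage⁻ () | no _

  -- The first element of L with image S; the default d is returned only if S is not a copy.
  representative : Subgraph n → Vec (Fin n) k → Vec (Fin n) k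
  representative S d = find-or (hasImage S) L d

  representative-ok : ∀ S d {h} → h ∈ L → image F h ≡ S →
    image F (representative S d) ≡ S × representative S d ∈ L
  representative-ok S d {h} h∈L e =
    let has , ∈L = find-or-satisfies (hasImage S) L d h∈L (hasImage⁺ {h = h} e)
    in hasImage⁻ {h = representative S d} has , ∈L

  representative-default : ∀ S d d′ {h} → h ∈ L → image F h ≡ S → representative S d ≡ representative S d′
  representative-default S d d′ {h} h∈L e =
    find-or-default-irrelevant (hasImage S) L d d′ h∈L (hasImage⁺ {h = h} e)

  #injHom≤copies*#aut : #injHom F G ≤ copies F G * #aut F
  #injHom≤copies*#aut = subst (#injHom F G ≤_) (length-cartesianProduct D A)
    (length-≤-injection L (cartesianProduct D A) φ (injHoms-unique F G) φ-inj φ∈)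
    where
    rep : Vec (Fin n) k → Vec (Fin n) k
    rep g = representative (image F g) g
    module T {g} (g∈L : g ∈ L) = Transition {F = F} {G} {rep g} {g}
      (∈-injHoms⁻ F G (proj₂ (representative-ok (image F g) g g∈L refl)))
      (∈-injHoms⁻ F G g∈L) (proj₁ (representative-ok (image F g) g g∈L refl))
    φ : (g : Vec (Fin n) k) → g ∈ L → Subgraph n × Vec (Fin k) k
    φ g _ = image F g , transition (rep g) g
    φ∈ : ∀ g g∈L → φ g g∈L ∈ cartesianProduct D A
    φ∈ g g∈L = ∈-cartesianProduct⁺ (∈-deduplicate⁺ subgraph-≟ (∈-map⁺ (image F) g∈L)) (∈-auts⁺ F _ (T.σ-aut g∈L))
    φ-inj : ∀ g g′ g∈L g′∈L → φ g g∈L ≡ φ g′ g′∈L → g ≡ g′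
    φ-inj g g′ g∈L g′∈L e = begin
      g                                  ≡⟨ T.g≡f∘ᵛσ g∈L ⟩
      rep g ∘ᵛ transition (rep g) g      ≡⟨ cong₂ _∘ᵛ_ same-rep (cong proj₂ e) ⟩
      rep g′ ∘ᵛ transition (rep g′) g′   ≡⟨ T.g≡f∘ᵛσ g′∈L ⟨
      g′                                 ∎
      where
      open ≡-Reasoning
      same-rep : rep g ≡ rep g′
      same-rep = trans (representative-default (image F g) g g′ g∈L refl)
                       (cong (λ S → representative S g′) (cong proj₁ e))

  copies*#aut≤#injHom : copies F G * #aut F ≤ #injHom F G
  copies*#aut≤#injHom = subst (_≤ #injHom F G) (length-cartesianProduct D A)
    (length-≤-injection (cartesianProduct D A) L φ
      (cartesianProduct⁺ (UniqueDec.deduplicate-! subgraph-≟ (map (image F) L)) (auts-unique F)) φ-inj φ∈)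
    where
    realised : ∀ x → x ∈ cartesianProduct D A → ∃ λ h → h ∈ L × proj₁ x ≡ image F h
    realised x x∈ =
      ∈-map⁻ (image F) (∈-deduplicate⁻ subgraph-≟ (map (image F) L) (proj₁ (∈-cartesianProduct⁻ D A x∈)))
    aut : ∀ x → x ∈ cartesianProduct D A → IsAut F (lookup (proj₂ x))
    aut x x∈ = ∈-auts⁻ F (proj₂ (∈-cartesianProduct⁻ D A x∈))
    rep : ∀ x → x ∈ cartesianProduct D A → Vec (Fin n) k
    rep x x∈ = representative (proj₁ x) (proj₁ (realised x x∈))
    rep-ok : ∀ x x∈ → image F (rep x x∈) ≡ proj₁ x × rep x x∈ ∈ L
    rep-ok x x∈ = let _ , h∈L , S≡ = realised x x∈ in representative-ok (proj₁ x) _ h∈L (sym S≡)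
    φ : ∀ x → x ∈ cartesianProduct D A → Vec (Fin n) k
    φ x x∈ = rep x x∈ ∘ᵛ proj₂ x
    φ∈ : ∀ x x∈ → φ x x∈ ∈ L
    φ∈ x x∈ = ∈-injHoms⁺ F G (φ x x∈)
      (∘ᵛ-injHom {f = rep x x∈} {σ = proj₂ x} (∈-injHoms⁻ F G (proj₂ (rep-ok x x∈))) (aut x x∈))
    image-φ : ∀ x x∈ → image F (φ x x∈) ≡ proj₁ x
    image-φ x x∈ = trans (image-∘ᵛ F (rep x x∈) (proj₂ x) (aut x x∈)) (proj₁ (rep-ok x x∈))
    φ-inj : ∀ x y x∈ y∈ → φ x x∈ ≡ φ y y∈ → x ≡ y
    φ-inj (S , σ) (S′ , τ) x∈ y∈ e = cong₂ _,_ S≡S′ σ≡τ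
      where
      S≡S′ : S ≡ S′
      S≡S′ = trans (sym (image-φ _ x∈)) (trans (cong (image F) e) (image-φ _ y∈))
      same-rep : rep (S , σ) x∈ ≡ rep (S′ , τ) y∈
      same-rep = let _ , h∈L , S≡ = realised _ x∈ in
        trans (representative-default S _ _ h∈L (sym S≡)) (cong (λ Z → representative Z (proj₁ (realised _ y∈))) S≡S′)
      σ≡τ : σ ≡ τ
      σ≡τ = Pointwise-≡⇒≡ (ext λ i → injective (∈-injHoms⁻ F G (proj₂ (rep-ok _ x∈))) (begin
        lookup r (lookup σ i)                  ≡⟨ lookup-∘ᵛ r σ i ⟨
        lookup (r ∘ᵛ σ) i                      ≡⟨ cong (λ z → lookup z i) e ⟩
        lookup (rep (S′ , τ) y∈ ∘ᵛ τ) i        ≡⟨ cong (λ z → lookup (z ∘ᵛ τ) i) same-rep ⟨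
        lookup (r ∘ᵛ τ) i                      ≡⟨ lookup-∘ᵛ r τ i ⟩
        lookup r (lookup τ i)                  ∎))
        where
        open ≡-Reasoning
        r = rep (S , σ) x∈

copies-mono : ∀ {k r n} (F : Graph k) (K : Graph r) (G : Graph n) →
  #injHom F K ≤ #injHom F G → copies F K ≤ copies F G
copies-mono F K G h = *-cancelʳ-≤ (copies F K) (copies F G) (#aut F) {{>-nonZero (#aut-pos F)}}
  (≤-trans (OrbitCounting.copies*#aut≤#injHom F K) (≤-trans h (OrbitCounting.#injHom≤copies*#aut F G)))

proposition6p3 : ∀ {k} (F : Graph k) → IsForest F → (t : ℕ) → 1 ≤ t →
    (r : ℕ) → IsRamseyNumber t r →
    ∀ {n} (G : Graph n) → KtRamsey t G → copies F (complete r) ≤ copies F G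
proposition6p3 F forest (suc t) _ zero (ramsey , _) G _ = ⊥-elim (¬KtRamsey-empty t ramsey)
proposition6p3 {k} F forest (suc t) _ (suc c) (_ , minimal) {n} G ramsey-G with colouring-or-core n G c
... | inj₁ colouring = ⊥-elim (minimal c ≤-refl (Colouring⇒KtRamsey-complete (suc t) G c colouring ramsey-G))
... | inj₂ core = copies-mono F (complete (suc c)) G (begin
  #injHom F (complete (suc c)) ≤⟨ #injHom-forest k F forest graph minDegree (Core-size core) ⟩
  #injHom F graph             ≤⟨ #injHom-embed F isEmbedding ⟩
  #injHom F G                 ∎)
  where
  open Core core
  open ≤-Reasoning
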